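{- Let $0\le r\le n$ and let $w=l_1\cdots l_n$ and $w'=l'_1\cdots l'_n$ be strings in $S(n,r)$ (written as sequences of their $n$ symbols). Then $w'$ covers $w$ in $(S(n,r),\sqsubseteq)$ if and only if there is exactly one index $k\in\{1,\dots,n\}$ with $l_k\ne l'_k$, and for this index $l'_k$ covers $l_k$ in the total order $\preceq$ of $A(n,r)$.
   Context: $A(n,r)$ is an alphabet of $n+1$ formal symbols $\tilde 1,\dots,\tilde r,\ 0^\S,\ \bar 1,\dots,\overline{n-r}$, totally ordered by $\overline{n-r}\prec\cdots\prec\bar1\prec 0^\S\prec\tilde1\prec\cdots\prec\tilde r$. $S(n,r)$ is the set of strings $w=i_1\cdots i_r\,|\,j_1\cdots j_{n-r}$ with $i_k\in\{\tilde1,\dots,\tilde r,0^\S\}$, $j_k\in\{0^\S,\bar1,\dots,\overline{n-r}\}$ such that for some $0\le p\le r$, $1\le q\le n-r+1$: $i_1\succ\cdots\succ i_p\succ 0^\S=i_{p+1}=\cdots=i_r$ and $j_1=\cdots=j_{q-1}=0^\S\succ j_q\succ\cdots\succ j_{n-r}$. $S(n,r)$ is ordered componentwise: $w\sqsubseteq w'$ iff each symbol of $w$ is $\preceq$ the symbol of $w'$ in the same position. "Covers" means: strictly greater with nothing strictly in between. -}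

module Defs where

open import Data.Nat using (ℕ; _<_; _≤_; _∸_; _+_; suc)
open import Data.Fin using (Fin; toℕ)
open import Data.Product using (Σ; ∃; _×_)
open import Data.Sum using (_⊎_)
open import Data.Unit using (⊤)
open import Data.Empty using (⊥)
open import Relation.Nullary using (¬_)
open import Relation.Binary.PropositionalEquality using (_≡_)

-- The alphabet A(n,r), with m = n - r.
--   tilde i  stands for  \tilde{(toℕ i + 1)}   (i : Fin r)
--   zs       stands for  0^§
--   bar j    stands for  \overline{(toℕ j + 1)} (j : Fin m)
data Sym (r m : ℕ) : Set where
  tilde : Fin r → Sym r m
  zs    : Sym r m
  bar   : Fin m → Sym r m

_≺_ : ∀ {r m} → Sym r m → Sym r m → Set
bar i   ≺ bar j   = toℕ j < toℕ i
bar _   ≺ zs      = ⊤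
bar _   ≺ tilde _ = ⊤
zs      ≺ tilde _ = ⊤
tilde i ≺ tilde j = toℕ i < toℕ j
_       ≺ _       = ⊥

_⪯_ : ∀ {r m} → Sym r m → Sym r m → Set
a ⪯ b = a ≺ b ⊎ a ≡ b

SymCovers : ∀ {r m} → Sym r m → Sym r m → Set
SymCovers a b = a ≺ b × ¬ (∃ λ c → a ≺ c × c ≺ b)

-- A string l_1 ... l_n over A(n,r), positions 0..n-1 (position k ↔ index k+1);
-- positions < r form the i-block, positions ≥ r the j-block.
Str : ℕ → ℕ → Set
Str n r = Fin n → Sym r (n ∸ r)

InS : (n r : ℕ) → Str n r → Set
InS n r w = Σ ℕ λ p → Σ ℕ λ q → p ≤ r × 1 ≤ q × q ≤ suc (n ∸ r) ×
  ((k k' : Fin n) → toℕ k < toℕ k' → toℕ k' < p → w k' ≺ w k) ×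
  -- i_p ≻ 0^§  (each of i_1..i_p lies above 0^§)
  ((k : Fin n) → toℕ k < p → zs ≺ w k) ×
  ((k : Fin n) → p ≤ toℕ k → toℕ k < r → w k ≡ zs) ×
  ((k : Fin n) → r ≤ toℕ k → toℕ k < r + (q ∸ 1) → w k ≡ zs) ×
  ((k : Fin n) → r + (q ∸ 1) ≤ toℕ k → w k ≺ zs) ×
  ((k k' : Fin n) → r + (q ∸ 1) ≤ toℕ k → toℕ k < toℕ k' → w k' ≺ w k)

_⊑_ : ∀ {n r} → Str n r → Str n r → Set
w ⊑ w' = ∀ k → w k ⪯ w' k

_≈_ : ∀ {n r} → Str n r → Str n r → Set
w ≈ w' = ∀ k → w k ≡ w' k

_⊏_ : ∀ {n r} → Str n r → Str n r → Set
w ⊏ w' = w ⊑ w' × ¬ (w ≈ w')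

SCovers : (n r : ℕ) → Str n r → Str n r → Set
SCovers n r w w' = w ⊏ w' × ¬ (∃ λ v → InS n r v × w ⊏ v × v ⊏ w')

-- A string strictly between w and w′ must agree with one of them at the only position where they
-- differ, which gives the backward direction for any componentwise order. Conversely, let k₀ be the
-- first position where w ≺ w′. Replacing w k₀ by any c with w k₀ ≺ c ⪯ w′ k₀ stays in S(n,r): c is
-- on the same side of 0^§ as w k₀ and w′ k₀, the blocks keep decreasing after k₀ because they do so
-- in w, and before k₀ because w agrees there with w′. The result lies strictly between w and w′
-- unless c = w′ k₀ and w′ differs from w only at k₀; so a cover w′ differs from w only at k₀, and
-- no c lies strictly between w k₀ and w′ k₀.
module Submission where

open import Defs
open import Data.Nat using (ℕ; _≤_; _<_; _+_; _∸_; zero; suc; z≤n; s≤s; s≤s⁻¹; _<?_; _≤?_)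
open import Data.Nat.Properties
  using (<-irrefl; ≤-refl; <-trans; <-≤-trans; ≤-<-trans; ≤-trans; <⇒≤; ≮⇒≥; m≤n⇒m<n∨m≡n; ∸-monoˡ-≤; m+[n∸m]≡n)
open import Data.Fin using (Fin; zero; suc; toℕ)
import Data.Fin as Fin
open import Data.Fin.Properties using (toℕ-injective; toℕ<n) renaming (<-cmp to <-cmp-Fin)
open import Data.Vec.Functional using (Vector; updateAt)
open import Data.Vec.Functional.Properties using (updateAt-updates; updateAt-minimal)
open import Data.Product using (Σ; ∃; _×_; _,_; proj₁)
open import Data.Sum using (_⊎_; inj₁; inj₂; map₂; [_,_]′)
open import Data.Unit using (tt)
open import Data.Empty using (⊥-elim)
open import Function using (const)
open import Function.Bundles using (_⇔_; mk⇔)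
open import Relation.Nullary using (¬_; yes; no)
open import Relation.Nullary.Decidable using (decidable-stable; _×-dec_)
open import Relation.Unary using (Pred; Decidable)
open import Relation.Binary.Definitions
  using (Irreflexive; Transitive; Trichotomous; Tri; tri<; tri≈; tri>; Antisymmetric)
open import Relation.Binary.Structures using (IsStrictTotalOrder)
open import Relation.Binary.PropositionalEquality
  using (_≡_; _≢_; refl; sym; trans; subst; isEquivalence; resp₂; respˡ)
import Relation.Binary.Construct.StrictToNonStrict as NonStrict

module _ {r m : ℕ} where

  ≺-irrefl : Irreflexive _≡_ (_≺_ {r} {m})
  ≺-irrefl {bar _}   refl i<i = <-irrefl refl i<i
  ≺-irrefl {zs}      refl ()
  ≺-irrefl {tilde _} refl i<i = <-irrefl refl i<i

  ≺-trans : Transitive (_≺_ {r} {m})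
  ≺-trans {bar _}   {bar _}   {bar _}   i≻j j≻k = <-trans j≻k i≻j
  ≺-trans {bar _}   {bar _}   {zs}      _   _   = tt
  ≺-trans {bar _}   {bar _}   {tilde _} _   _   = tt
  ≺-trans {bar _}   {zs}      {tilde _} _   _   = tt
  ≺-trans {bar _}   {tilde _} {tilde _} _   _   = tt
  ≺-trans {zs}      {tilde _} {tilde _} _   _   = tt
  ≺-trans {tilde _} {tilde _} {tilde _} i<j j<k = <-trans i<j j<k

  private
    tri<′ : {a b : Sym r m} → a ≺ b → Tri (a ≺ b) (a ≡ b) (b ≺ a)
    tri<′ a<b = tri< a<b (λ a≡b → ≺-irrefl a≡b a<b) (λ b<a → ≺-irrefl refl (≺-trans a<b b<a))

    tri>′ : {a b : Sym r m} → b ≺ a → Tri (a ≺ b) (a ≡ b) (b ≺ a)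
    tri>′ b<a = tri> (λ a<b → ≺-irrefl refl (≺-trans a<b b<a)) (λ a≡b → ≺-irrefl (sym a≡b) b<a) b<a

    tri≈′ : {a : Sym r m} → Tri (a ≺ a) (a ≡ a) (a ≺ a)
    tri≈′ = tri≈ (≺-irrefl refl) refl (≺-irrefl refl)

  ≺-compare : Trichotomous _≡_ (_≺_ {r} {m})
  ≺-compare (bar i) (bar j) with <-cmp-Fin i j
  ... | tri< i<j _ _ = tri>′ i<j
  ... | tri≈ _ refl _ = tri≈′
  ... | tri> _ _ j<i = tri<′ j<i
  ≺-compare (bar _)   zs        = tri<′ tt
  ≺-compare (bar _)   (tilde _) = tri<′ tt
  ≺-compare zs        (bar _)   = tri>′ tt
  ≺-compare zs        zs        = tri≈′
  ≺-compare zs        (tilde _) = tri<′ tt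
  ≺-compare (tilde _) (bar _)   = tri>′ tt
  ≺-compare (tilde _) zs        = tri>′ tt
  ≺-compare (tilde i) (tilde j) with <-cmp-Fin i j
  ... | tri< i<j _ _ = tri<′ i<j
  ... | tri≈ _ refl _ = tri≈′
  ... | tri> _ _ j<i = tri>′ j<i

  ≺-isStrictTotalOrder : IsStrictTotalOrder _≡_ (_≺_ {r} {m})
  ≺-isStrictTotalOrder = record
    { isStrictPartialOrder = record
      { isEquivalence = isEquivalence
      ; irrefl        = ≺-irrefl
      ; trans         = ≺-trans
      ; <-resp-≈      = resp₂ _≺_
      }
    ; compare = ≺-compare
    }

  open IsStrictTotalOrder ≺-isStrictTotalOrder public using (_≟_) renaming (_<?_ to _≺?_)

  ⪯-trans : Transitive (_⪯_ {r} {m})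
  ⪯-trans = NonStrict.trans _≡_ _≺_ isEquivalence (resp₂ _≺_) ≺-trans

  ⪯-antisym : Antisymmetric _≡_ (_⪯_ {r} {m})
  ⪯-antisym = NonStrict.antisym _≡_ _≺_ isEquivalence ≺-trans ≺-irrefl

  ⪯-≺-trans : {a b c : Sym r m} → a ⪯ b → b ≺ c → a ≺ c
  ⪯-≺-trans = NonStrict.≤-<-trans _≡_ _≺_ sym ≺-trans (respˡ _≺_)

  ⪯⇒⊀ : {a b : Sym r m} → a ⪯ b → ¬ b ≺ a
  ⪯⇒⊀ a⪯b b≺a = ≺-irrefl refl (⪯-≺-trans a⪯b b≺a)

  ⪯∧≢⇒≺ : {a b : Sym r m} → a ⪯ b → a ≢ b → a ≺ b
  ⪯∧≢⇒≺ (inj₁ a≺b) _   = a≺b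
  ⪯∧≢⇒≺ (inj₂ a≡b) a≢b = ⊥-elim (a≢b a≡b)

  ⪯∧⊀⇒≡ : {a b : Sym r m} → a ⪯ b → ¬ a ≺ b → a ≡ b
  ⪯∧⊀⇒≡ (inj₁ a≺b) a⊀b = ⊥-elim (a⊀b a≺b)
  ⪯∧⊀⇒≡ (inj₂ a≡b) _   = a≡b

  covers⇒no-middle : {a b c : Sym r m} → SymCovers a b → a ⪯ c → c ⪯ b → c ≡ a ⊎ c ≡ b
  covers⇒no-middle _           (inj₂ a≡c) _          = inj₁ (sym a≡c)
  covers⇒no-middle _           (inj₁ _)   (inj₂ c≡b) = inj₂ c≡b
  covers⇒no-middle (_ , empty) (inj₁ a≺c) (inj₁ c≺b) = ⊥-elim (empty (_ , a≺c , c≺b))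

least-or-none : ∀ {n ℓ} {P : Pred (Fin n) ℓ} → Decidable P →
  (∀ i → ¬ P i) ⊎ ∃ λ i → P i × (∀ j → toℕ j < toℕ i → ¬ P j)
least-or-none {zero} P? = inj₁ λ ()
least-or-none {suc n} P? with P? zero
... | yes P0 = inj₂ (zero , P0 , λ _ ())
... | no ¬P0 with least-or-none (λ i → P? (suc i))
...   | inj₁ none = inj₁ λ { zero → ¬P0 ; (suc i) → none i }
...   | inj₂ (i , Pi , least) =
        inj₂ (suc i , Pi , λ { zero _ → ¬P0 ; (suc j) j<i → least j (s≤s⁻¹ j<i) })

first-in-window : ∀ {n ℓ} {P : Pred (Fin n) ℓ} → Decidable P → ∀ {a b} → a ≤ b →
  Σ ℕ λ p → a ≤ p × p ≤ b × (∀ k → a ≤ toℕ k → toℕ k < p → ¬ P k) ×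
            (p < b → ∃ λ k → toℕ k ≡ p × P k)
first-in-window {P = P} P? {a} {b} a≤b with least-or-none {P = InWindow} InWindow?
  where
  InWindow : Pred (Fin _) _
  InWindow k = a ≤ toℕ k × toℕ k < b × P k
  InWindow? : Decidable InWindow
  InWindow? k = (a ≤? toℕ k) ×-dec (toℕ k <? b) ×-dec P? k
... | inj₁ none =
  b , a≤b , ≤-refl , (λ k a≤k k<b Pk → none k (a≤k , k<b , Pk)) , λ b<b → ⊥-elim (<-irrefl refl b<b)
... | inj₂ (k , (a≤k , k<b , Pk) , least) =
  toℕ k , a≤k , <⇒≤ k<b , (λ j a≤j j<k Pj → least j j<k (a≤j , <-trans j<k k<b , Pj)) , λ _ → k , refl , Pk

-- Membership in S(n,r) without the witnesses p and q: each block is on its side of 0^§ and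
-- strictly decreasing except where 0^§ sits (at the end of the i-block, at the start of the j-block).
record WellShaped (n r : ℕ) (w : Str n r) : Set where
  field
    i-nonneg     : ∀ k → toℕ k < r → zs ⪯ w k
    j-nonpos     : ∀ k → r ≤ toℕ k → w k ⪯ zs
    i-decreasing : ∀ k k′ → toℕ k < toℕ k′ → toℕ k′ < r → w k′ ≡ zs ⊎ w k′ ≺ w k
    j-decreasing : ∀ k k′ → r ≤ toℕ k → toℕ k < toℕ k′ → w k ≡ zs ⊎ w k′ ≺ w k

module _ {n r : ℕ} {w : Str n r} where

  InS⇒WellShaped : InS n r w → WellShaped n r w
  InS⇒WellShaped (p , q , _ , _ , _ , i-dec , i-pos , i-zero , j-zero , j-neg , j-dec) = record
    { i-nonneg     = i-nonneg
    ; j-nonpos     = j-nonpos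
    ; i-decreasing = i-decreasing
    ; j-decreasing = j-decreasing
    }
    where
    i-nonneg : ∀ k → toℕ k < r → zs ⪯ w k
    i-nonneg k k<r with toℕ k <? p
    ... | yes k<p = inj₁ (i-pos k k<p)
    ... | no  k≮p = inj₂ (sym (i-zero k (≮⇒≥ k≮p) k<r))

    j-nonpos : ∀ k → r ≤ toℕ k → w k ⪯ zs
    j-nonpos k r≤k with toℕ k <? r + (q ∸ 1)
    ... | yes k<t = inj₂ (j-zero k r≤k k<t)
    ... | no  k≮t = inj₁ (j-neg k (≮⇒≥ k≮t))

    i-decreasing : ∀ k k′ → toℕ k < toℕ k′ → toℕ k′ < r → w k′ ≡ zs ⊎ w k′ ≺ w k
    i-decreasing k k′ k<k′ k′<r with toℕ k′ <? p
    ... | yes k′<p = inj₂ (i-dec k k′ k<k′ k′<p)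
    ... | no  k′≮p = inj₁ (i-zero k′ (≮⇒≥ k′≮p) k′<r)

    j-decreasing : ∀ k k′ → r ≤ toℕ k → toℕ k < toℕ k′ → w k ≡ zs ⊎ w k′ ≺ w k
    j-decreasing k k′ r≤k k<k′ with toℕ k <? r + (q ∸ 1)
    ... | yes k<t = inj₁ (j-zero k r≤k k<t)
    ... | no  k≮t = inj₂ (j-dec k k′ (≮⇒≥ k≮t) k<k′)

  module _ (ws : WellShaped n r w) where
    open WellShaped ws

    zs-propagates : ∀ {j k} → w j ≡ zs → toℕ j ≤ toℕ k → toℕ k < r → w k ≡ zs
    zs-propagates {j} {k} wj≡zs j≤k k<r with m≤n⇒m<n∨m≡n j≤k
    ... | inj₂ j≡k = subst (λ i → w i ≡ zs) (toℕ-injective j≡k) wj≡zs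
    ... | inj₁ j<k with i-decreasing j k j<k k<r
    ...   | inj₁ wk≡zs = wk≡zs
    ...   | inj₂ wk≺wj = ⊥-elim (⪯⇒⊀ (i-nonneg k k<r) (subst (w k ≺_) wj≡zs wk≺wj))

    negative-propagates : ∀ {j k} → r ≤ toℕ j → w j ≺ zs → toℕ j ≤ toℕ k → w k ≺ zs
    negative-propagates {j} {k} r≤j wj≺zs j≤k with m≤n⇒m<n∨m≡n j≤k
    ... | inj₂ j≡k = subst (λ i → w i ≺ zs) (toℕ-injective j≡k) wj≺zs
    ... | inj₁ j<k with j-decreasing j k r≤j j<k
    ...   | inj₁ wj≡zs = ⊥-elim (≺-irrefl wj≡zs wj≺zs)
    ...   | inj₂ wk≺wj = ≺-trans wk≺wj wj≺zs

    WellShaped⇒InS : r ≤ n → InS n r w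
    WellShaped⇒InS r≤n
      with first-in-window (λ k → w k ≟ zs) {0} z≤n | first-in-window (λ k → w k ≺? zs) r≤n
    ... | p , _ , p≤r , zs-free , first-zs | s , r≤s , s≤n , negative-free , first-negative =
      p , suc (s ∸ r) , p≤r , s≤s z≤n , s≤s (∸-monoˡ-≤ r s≤n) , i-dec , i-pos , i-zero ,
      (λ k r≤k k<t → j-zero k r≤k (subst (toℕ k <_) r+[s∸r]≡s k<t)) ,
      (λ k t≤k → j-neg k (subst (_≤ toℕ k) r+[s∸r]≡s t≤k)) ,
      (λ k k′ t≤k → j-dec k k′ (subst (_≤ toℕ k) r+[s∸r]≡s t≤k))
      where
      r+[s∸r]≡s : r + (s ∸ r) ≡ s
      r+[s∸r]≡s = m+[n∸m]≡n r≤s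

      i-dec : ∀ k k′ → toℕ k < toℕ k′ → toℕ k′ < p → w k′ ≺ w k
      i-dec k k′ k<k′ k′<p with i-decreasing k k′ k<k′ (<-≤-trans k′<p p≤r)
      ... | inj₁ wk′≡zs = ⊥-elim (zs-free k′ z≤n k′<p wk′≡zs)
      ... | inj₂ wk′≺wk = wk′≺wk

      i-pos : ∀ k → toℕ k < p → zs ≺ w k
      i-pos k k<p = ⪯∧≢⇒≺ (i-nonneg k (<-≤-trans k<p p≤r)) (λ zs≡wk → zs-free k z≤n k<p (sym zs≡wk))

      i-zero : ∀ k → p ≤ toℕ k → toℕ k < r → w k ≡ zs
      i-zero k p≤k k<r with first-zs (≤-<-trans p≤k k<r)
      ... | j , j≡p , wj≡zs = zs-propagates wj≡zs (subst (_≤ toℕ k) (sym j≡p) p≤k) k<r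

      j-zero : ∀ k → r ≤ toℕ k → toℕ k < s → w k ≡ zs
      j-zero k r≤k k<s = ⪯∧⊀⇒≡ (j-nonpos k r≤k) (negative-free k r≤k k<s)

      j-neg : ∀ k → s ≤ toℕ k → w k ≺ zs
      j-neg k s≤k with first-negative (≤-<-trans s≤k (toℕ<n k))
      ... | j , j≡s , wj≺zs =
        negative-propagates (subst (r ≤_) (sym j≡s) r≤s) wj≺zs (subst (_≤ toℕ k) (sym j≡s) s≤k)

      j-dec : ∀ k k′ → s ≤ toℕ k → toℕ k < toℕ k′ → w k′ ≺ w k
      j-dec k k′ s≤k k<k′ with j-decreasing k k′ (≤-trans r≤s s≤k) k<k′
      ... | inj₁ wk≡zs = ⊥-elim (≺-irrefl wk≡zs (j-neg k s≤k))
      ... | inj₂ wk′≺wk = wk′≺wk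

infixl 6 _[_]≔_

_[_]≔_ : ∀ {a} {A : Set a} {n} → Vector A n → Fin n → A → Vector A n
xs [ i ]≔ x = updateAt xs i (const x)

module _ {a} {A : Set a} {n} (xs : Vector A n) (i : Fin n) (x : A) where

  []≔-updates : (xs [ i ]≔ x) i ≡ x
  []≔-updates = updateAt-updates i xs

  []≔-minimal : ∀ {j} → j ≢ i → (xs [ i ]≔ x) j ≡ xs j
  []≔-minimal j≢i = updateAt-minimal _ i xs j≢i

module _ {n r : ℕ} {w : Str n r} {k₀ : Fin n} {c : Sym r (n ∸ r)} where

  []≔-⊏ : w k₀ ≺ c → w ⊏ (w [ k₀ ]≔ c)
  []≔-⊏ wk₀≺c = below , λ w≈v → ≺-irrefl (trans (w≈v k₀) ([]≔-updates w k₀ c)) wk₀≺c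
    where
    below : w ⊑ (w [ k₀ ]≔ c)
    below k with k Fin.≟ k₀
    ... | yes refl rewrite []≔-updates w k₀ c = inj₁ wk₀≺c
    ... | no  k≢k₀ rewrite []≔-minimal w k₀ c k≢k₀ = inj₂ refl

  []≔-⊑ : {w′ : Str n r} → w ⊑ w′ → c ⪯ w′ k₀ → (w [ k₀ ]≔ c) ⊑ w′
  []≔-⊑ w⊑w′ c⪯w′k₀ k with k Fin.≟ k₀
  ... | yes refl rewrite []≔-updates w k₀ c = c⪯w′k₀
  ... | no  k≢k₀ rewrite []≔-minimal w k₀ c k≢k₀ = w⊑w′ k

  []≔-WellShaped : {w′ : Str n r} → WellShaped n r w → WellShaped n r w′ →
    (∀ k → toℕ k < toℕ k₀ → w k ≡ w′ k) → w k₀ ≺ c → c ⪯ w′ k₀ → WellShaped n r (w [ k₀ ]≔ c)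
  []≔-WellShaped {w′} ws ws′ agree wk₀≺c c⪯w′k₀ = record
    { i-nonneg     = i-nonneg
    ; j-nonpos     = j-nonpos
    ; i-decreasing = i-decreasing
    ; j-decreasing = j-decreasing
    }
    where
    module W = WellShaped ws
    module W′ = WellShaped ws′

    c≡zs : zs ≺ c → c ⪯ zs → c ≡ zs
    c≡zs zs≺c c⪯zs = ⪯-antisym c⪯zs (inj₁ zs≺c)

    i-nonneg : ∀ k → toℕ k < r → zs ⪯ (w [ k₀ ]≔ c) k
    i-nonneg k k<r with k Fin.≟ k₀
    ... | yes refl rewrite []≔-updates w k₀ c = inj₁ (⪯-≺-trans (W.i-nonneg k₀ k<r) wk₀≺c)
    ... | no  k≢k₀ rewrite []≔-minimal w k₀ c k≢k₀ = W.i-nonneg k k<r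

    j-nonpos : ∀ k → r ≤ toℕ k → (w [ k₀ ]≔ c) k ⪯ zs
    j-nonpos k r≤k with k Fin.≟ k₀
    ... | yes refl rewrite []≔-updates w k₀ c = ⪯-trans c⪯w′k₀ (W′.j-nonpos k₀ r≤k)
    ... | no  k≢k₀ rewrite []≔-minimal w k₀ c k≢k₀ = W.j-nonpos k r≤k

    i-decreasing : ∀ k k′ → toℕ k < toℕ k′ → toℕ k′ < r →
      (w [ k₀ ]≔ c) k′ ≡ zs ⊎ (w [ k₀ ]≔ c) k′ ≺ (w [ k₀ ]≔ c) k
    i-decreasing k k′ k<k′ k′<r with k Fin.≟ k₀ | k′ Fin.≟ k₀
    ... | yes refl | yes refl = ⊥-elim (<-irrefl refl k<k′)
    ... | yes refl | no k′≢k₀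
      rewrite []≔-updates w k₀ c | []≔-minimal w k₀ c k′≢k₀ =
        map₂ (λ wk′≺wk₀ → ≺-trans wk′≺wk₀ wk₀≺c) (W.i-decreasing k₀ k′ k<k′ k′<r)
    ... | no k≢k₀ | yes refl
      rewrite []≔-updates w k₀ c | []≔-minimal w k₀ c k≢k₀ | agree k k<k′
      with W′.i-decreasing k k₀ k<k′ k′<r
    ...   | inj₁ w′k₀≡zs =
            inj₁ (c≡zs (⪯-≺-trans (W.i-nonneg k₀ k′<r) wk₀≺c) (subst (c ⪯_) w′k₀≡zs c⪯w′k₀))
    ...   | inj₂ w′k₀≺w′k = inj₂ (⪯-≺-trans c⪯w′k₀ w′k₀≺w′k)
    i-decreasing k k′ k<k′ k′<r | no k≢k₀ | no k′≢k₀
      rewrite []≔-minimal w k₀ c k≢k₀ | []≔-minimal w k₀ c k′≢k₀ = W.i-decreasing k k′ k<k′ k′<r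

    j-decreasing : ∀ k k′ → r ≤ toℕ k → toℕ k < toℕ k′ →
      (w [ k₀ ]≔ c) k ≡ zs ⊎ (w [ k₀ ]≔ c) k′ ≺ (w [ k₀ ]≔ c) k
    j-decreasing k k′ r≤k k<k′ with k Fin.≟ k₀ | k′ Fin.≟ k₀
    ... | yes refl | yes refl = ⊥-elim (<-irrefl refl k<k′)
    ... | yes refl | no k′≢k₀
      rewrite []≔-updates w k₀ c | []≔-minimal w k₀ c k′≢k₀
      with W.j-decreasing k₀ k′ r≤k k<k′
    ...   | inj₁ wk₀≡zs =
            inj₁ (c≡zs (subst (_≺ c) wk₀≡zs wk₀≺c) (⪯-trans c⪯w′k₀ (W′.j-nonpos k₀ r≤k)))
    ...   | inj₂ wk′≺wk₀ = inj₂ (≺-trans wk′≺wk₀ wk₀≺c)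
    j-decreasing k k′ r≤k k<k′ | no k≢k₀ | yes refl
      rewrite []≔-updates w k₀ c | []≔-minimal w k₀ c k≢k₀ | agree k k<k′ =
        map₂ (⪯-≺-trans c⪯w′k₀) (W′.j-decreasing k k₀ r≤k k<k′)
    j-decreasing k k′ r≤k k<k′ | no k≢k₀ | no k′≢k₀
      rewrite []≔-minimal w k₀ c k≢k₀ | []≔-minimal w k₀ c k′≢k₀ = W.j-decreasing k k′ r≤k k<k′

agree-everywhere : ∀ {n r} {v w : Str n r} {k} → v k ≡ w k → (∀ j → j ≢ k → v j ≡ w j) → v ≈ w
agree-everywhere {k = k} vk≡wk agree j with j Fin.≟ k
... | yes refl = vk≡wk
... | no  j≢k  = agree j j≢k

module _ {n r : ℕ} {w w′ : Str n r} where

  unique⇒agree-off : ∀ {k} → (∀ j → w j ≢ w′ j → j ≡ k) → ∀ j → j ≢ k → w j ≡ w′ j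
  unique⇒agree-off unique j j≢k = decidable-stable (w j ≟ w′ j) (λ wj≢w′j → j≢k (unique j wj≢w′j))

  agree-off⇒unique : ∀ {k} → (∀ j → j ≢ k → w j ≡ w′ j) → ∀ j → w j ≢ w′ j → j ≡ k
  agree-off⇒unique {k} agree j wj≢w′j = decidable-stable (j Fin.≟ k) (λ j≢k → wj≢w′j (agree j j≢k))

  covers-at⇒SCovers : ∀ {k} → SymCovers (w k) (w′ k) → (∀ j → j ≢ k → w j ≡ w′ j) → SCovers n r w w′
  covers-at⇒SCovers {k} cover agree = (w⊑w′ , λ w≈w′ → ≺-irrefl (w≈w′ k) (proj₁ cover)) , nothing-between
    where
    w⊑w′ : w ⊑ w′
    w⊑w′ j with j Fin.≟ k
    ... | yes refl = inj₁ (proj₁ cover)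
    ... | no  j≢k  = inj₂ (agree j j≢k)

    nothing-between : ¬ ∃ λ v → InS n r v × w ⊏ v × v ⊏ w′
    nothing-between (v , _ , (w⊑v , w≉v) , (v⊑w′ , v≉w′)) =
      [ (λ vk≡wk → w≉v (λ j → sym (agree-everywhere vk≡wk v≡w-off j)))
      , (λ vk≡w′k → v≉w′ (agree-everywhere vk≡w′k (λ j j≢k → trans (v≡w-off j j≢k) (agree j j≢k))))
      ]′ (covers⇒no-middle cover (w⊑v k) (v⊑w′ k))
      where
      v≡w-off : ∀ j → j ≢ k → v j ≡ w j
      v≡w-off j j≢k = ⪯-antisym (subst (v j ⪯_) (sym (agree j j≢k)) (v⊑w′ j)) (w⊑v j)

  SCovers⇒covers-at : r ≤ n → InS n r w → InS n r w′ → SCovers n r w w′ →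
    ∃ λ k → SymCovers (w k) (w′ k) × (∀ j → j ≢ k → w j ≡ w′ j)
  SCovers⇒covers-at r≤n sw sw′ ((w⊑w′ , w≉w′) , nothing-between)
    with least-or-none (λ k → w k ≺? w′ k)
  ... | inj₁ none = ⊥-elim (w≉w′ (λ k → ⪯∧⊀⇒≡ (w⊑w′ k) (none k)))
  ... | inj₂ (k₀ , wk₀≺w′k₀ , first) = k₀ , (wk₀≺w′k₀ , no-middle) , agree-off
    where
    raise-InS : ∀ {c} → w k₀ ≺ c → c ⪯ w′ k₀ → InS n r (w [ k₀ ]≔ c)
    raise-InS wk₀≺c c⪯w′k₀ = WellShaped⇒InS
      ([]≔-WellShaped (InS⇒WellShaped sw) (InS⇒WellShaped sw′)
        (λ k k<k₀ → ⪯∧⊀⇒≡ (w⊑w′ k) (first k k<k₀)) wk₀≺c c⪯w′k₀)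
      r≤n

    no-middle : ¬ ∃ λ c → w k₀ ≺ c × c ≺ w′ k₀
    no-middle (c , wk₀≺c , c≺w′k₀) = nothing-between
      (w [ k₀ ]≔ c , raise-InS wk₀≺c (inj₁ c≺w′k₀) , []≔-⊏ wk₀≺c ,
       ([]≔-⊑ w⊑w′ (inj₁ c≺w′k₀) , λ v≈w′ → ≺-irrefl (trans (sym ([]≔-updates w k₀ c)) (v≈w′ k₀)) c≺w′k₀))

    agree-off : ∀ j → j ≢ k₀ → w j ≡ w′ j
    agree-off j j≢k₀ = decidable-stable (w j ≟ w′ j) λ wj≢w′j → nothing-between
      (w [ k₀ ]≔ w′ k₀ , raise-InS wk₀≺w′k₀ (inj₂ refl) , []≔-⊏ wk₀≺w′k₀ ,
       ([]≔-⊑ w⊑w′ (inj₂ refl) , λ v≈w′ → wj≢w′j (trans (sym ([]≔-minimal w k₀ (w′ k₀) j≢k₀)) (v≈w′ j))))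

mainTheorem4 : (n r : ℕ) → r ≤ n → (w w' : Str n r) → InS n r w → InS n r w' →
    SCovers n r w w' ⇔
    Σ (Fin n) (λ k → ¬ (w k ≡ w' k) × ((k' : Fin n) → ¬ (w k' ≡ w' k') → k' ≡ k) ×
    SymCovers (w k) (w' k))
mainTheorem4 n r r≤n w w' sw sw' = mk⇔
  (λ cov → let (k , cover , agree) = SCovers⇒covers-at r≤n sw sw' cov
           in k , (λ wk≡w'k → ≺-irrefl wk≡w'k (proj₁ cover)) , agree-off⇒unique agree , cover)
  (λ (_ , _ , unique , cover) → covers-at⇒SCovers cover (unique⇒agree-off unique))
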